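{- For every Magari algebra $\mathfrak{A}$ and every msi rule $\Gamma/\Delta$, we have $\mathfrak{A}\models T(\Gamma/\Delta)$ if and only if $\rho\mathfrak{A}\models\Gamma/\Delta$.
   Context: Msi formulae: built from variables, $\bot,\top$ with $\land,\lor,\to,\boxtimes$; an msi rule is a pair $\Gamma/\Delta$ of finite sets of msi formulae. A Magari algebra is a modal algebra (Boolean algebra with $\square$, $\square1=1$, $\square(a\land b)=\square a\land\square b$) satisfying $\square(\square a\to a)=\square a$. Write $\square^+x:=\square x\land x$. For a Magari algebra $\mathfrak{A}$, $\rho\mathfrak{A}$ is the fronton with carrier $O(A)=\{a:\square^+a=a\}$, the lattice operations and $0,1$ of $\mathfrak{A}$, $a\to b:=\square^+(\neg a\lor b)$ and $\boxtimes a:=\square a$. The translation $T$ from msi to modal formulae: $T(\bot)=\bot$, $T(\top)=\top$, $T(p)=\square^+p$, $T$ commutes with $\land,\lor$, $T(\varphi\to\psi)=\square^+(\neg T\varphi\lor T\psi)$, $T(\boxtimes\varphi)=\square T\varphi$, and $T(\Gamma/\Delta)=T[\Gamma]/T[\Delta]$. A rule is valid on an algebra if every valuation making all premises $1$ makes some conclusion $1$. -}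

module Defs where

open import Level using (Level; _⊔_; suc)
open import Data.Nat using (ℕ)
open import Data.List using (List; map)
open import Data.List.Relation.Unary.All using (All)
open import Data.List.Relation.Unary.Any using (Any)
open import Data.Product using (Σ; proj₁)
open import Algebra.Lattice.Bundles using (BooleanAlgebra)
open import Relation.Binary.Core using (_Preserves_⟶_)

record MagariAlgebra (c ℓ : Level) : Set (suc (c ⊔ ℓ)) where
  field
    booleanAlgebra : BooleanAlgebra c ℓ
  open BooleanAlgebra booleanAlgebra public
  field
    □        : Carrier → Carrier
    □-cong   : □ Preserves _≈_ ⟶ _≈_
    □-⊤      : □ ⊤ ≈ ⊤
    □-∧      : ∀ a b → □ (a ∧ b) ≈ □ a ∧ □ b
    □-löb    : ∀ a → □ ((¬ (□ a)) ∨ a) ≈ □ a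

  □⁺ : Carrier → Carrier
  □⁺ x = □ x ∧ x

  -- the carrier of the fronton ρ𝔄 : O(A) = { a | □⁺ a = a }
  Open : Carrier → Set ℓ
  Open a = □⁺ a ≈ a

  O : Set (c ⊔ ℓ)
  O = Σ Carrier Open

  _⇒ρ_ : Carrier → Carrier → Carrier
  a ⇒ρ b = □⁺ ((¬ a) ∨ b)

  ⊠ρ : Carrier → Carrier
  ⊠ρ a = □ a

data MsiForm : Set where
  var  : ℕ → MsiForm
  ⊥ᵐ ⊤ᵐ : MsiForm
  _∧ᵐ_ _∨ᵐ_ _→ᵐ_ : MsiForm → MsiForm → MsiForm
  ⊠ᵐ   : MsiForm → MsiForm

record MsiRule : Set where
  constructor _/_
  field
    premises    : List MsiForm
    conclusions : List MsiForm

data ModForm : Set where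
  var  : ℕ → ModForm
  ⊥ᵈ ⊤ᵈ : ModForm
  _∧ᵈ_ _∨ᵈ_ : ModForm → ModForm → ModForm
  ¬ᵈ_  : ModForm → ModForm
  □ᵈ   : ModForm → ModForm

record ModRule : Set where
  constructor _/_
  field
    premises    : List ModForm
    conclusions : List ModForm

□⁺ᵈ : ModForm → ModForm
□⁺ᵈ φ = □ᵈ φ ∧ᵈ φ

T : MsiForm → ModForm
T (var p)   = □⁺ᵈ (var p)
T ⊥ᵐ        = ⊥ᵈ
T ⊤ᵐ        = ⊤ᵈ
T (φ ∧ᵐ ψ)  = T φ ∧ᵈ T ψ
T (φ ∨ᵐ ψ)  = T φ ∨ᵈ T ψ
T (φ →ᵐ ψ)  = □⁺ᵈ ((¬ᵈ T φ) ∨ᵈ T ψ)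
T (⊠ᵐ φ)    = □ᵈ (T φ)

Tʳ : MsiRule → ModRule
Tʳ (Γ / Δ) = map T Γ / map T Δ

module _ {c ℓ : Level} (𝔄 : MagariAlgebra c ℓ) where
  open MagariAlgebra 𝔄

  ⟦_⟧ᵈ : ModForm → (ℕ → Carrier) → Carrier
  ⟦ var p ⟧ᵈ v   = v p
  ⟦ ⊥ᵈ ⟧ᵈ v      = ⊥
  ⟦ ⊤ᵈ ⟧ᵈ v      = ⊤
  ⟦ φ ∧ᵈ ψ ⟧ᵈ v  = ⟦ φ ⟧ᵈ v ∧ ⟦ ψ ⟧ᵈ v
  ⟦ φ ∨ᵈ ψ ⟧ᵈ v  = ⟦ φ ⟧ᵈ v ∨ ⟦ ψ ⟧ᵈ v
  ⟦ ¬ᵈ φ ⟧ᵈ v    = ¬ ⟦ φ ⟧ᵈ v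
  ⟦ □ᵈ φ ⟧ᵈ v    = □ (⟦ φ ⟧ᵈ v)

  ValidModal : ModRule → Set (c ⊔ ℓ)
  ValidModal (Γ / Δ) =
    (v : ℕ → Carrier) →
    All (λ φ → ⟦ φ ⟧ᵈ v ≈ ⊤) Γ → Any (λ φ → ⟦ φ ⟧ᵈ v ≈ ⊤) Δ

  -- evaluation of msi formulae in the fronton ρ𝔄; a valuation assigns
  -- to each variable an element of O(A), and the fronton operations are
  -- computed on underlying elements of A (O(A) is closed under them).
  ⟦_⟧ρ : MsiForm → (ℕ → O) → Carrier
  ⟦ var p ⟧ρ v   = proj₁ (v p)
  ⟦ ⊥ᵐ ⟧ρ v      = ⊥
  ⟦ ⊤ᵐ ⟧ρ v      = ⊤
  ⟦ φ ∧ᵐ ψ ⟧ρ v  = ⟦ φ ⟧ρ v ∧ ⟦ ψ ⟧ρ v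
  ⟦ φ ∨ᵐ ψ ⟧ρ v  = ⟦ φ ⟧ρ v ∨ ⟦ ψ ⟧ρ v
  ⟦ φ →ᵐ ψ ⟧ρ v  = ⟦ φ ⟧ρ v ⇒ρ ⟦ ψ ⟧ρ v
  ⟦ ⊠ᵐ φ ⟧ρ v    = ⊠ρ (⟦ φ ⟧ρ v)

  ValidRho : MsiRule → Set (c ⊔ ℓ)
  ValidRho (Γ / Δ) =
    (v : ℕ → O) →
    All (λ φ → ⟦ φ ⟧ρ v ≈ ⊤) Γ → Any (λ φ → ⟦ φ ⟧ρ v ≈ ⊤) Δ

-- Löb's axiom, applied to □⁺ x, yields □x ≤ □□x, so every □⁺ x is open.
-- Hence every valuation v into 𝔄 induces the valuation p ↦ □⁺ (v p) into
-- ρ𝔄, every valuation into ρ𝔄 is of this form up to ≈, and for such a pair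
-- ⟦ T φ ⟧ at v equals ⟦ φ ⟧ at p ↦ □⁺ (v p) by induction on φ. So T(Γ/Δ)
-- fails under v exactly when Γ/Δ fails under the induced valuation.
module Submission where

open import Defs
open import Level using (Level)
open import Function.Base using (_∘_)
open import Function.Bundles using (_⇔_; mk⇔; Equivalence)
open import Function.Related.TypeIsomorphisms using (→-cong-⇔)
open import Data.Nat using (ℕ)
open import Data.Product using (_,_; proj₁; proj₂)
open import Data.List using (map)
open import Data.List.Relation.Unary.All as All using (All)
open import Data.List.Relation.Unary.Any as Any using (Any)
import Data.List.Relation.Unary.All.Properties as AllP
import Data.List.Relation.Unary.Any.Properties as AnyP
open import Algebra.Lattice.Properties.BooleanAlgebra using (∧-identityʳ)
import Algebra.Lattice.Properties.Lattice as LatticeProperties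
import Relation.Binary.Lattice.Bundles as OrderLattice
import Relation.Binary.Lattice.Properties.JoinSemilattice as JoinSemilatticeProperties
import Relation.Binary.Reasoning.PartialOrder as ≤-Reasoning

module _ {a b p q : Level} {A : Set a} {B : Set b}
         {P : B → Set p} {Q : A → Set q} {f : A → B}
         (P∘f⇔Q : ∀ x → P (f x) ⇔ Q x) where

  All-map-⇔ : ∀ xs → All P (map f xs) ⇔ All Q xs
  All-map-⇔ xs = mk⇔
    (All.map (λ {x} → Equivalence.to (P∘f⇔Q x)) ∘ AllP.map⁻)
    (AllP.map⁺ ∘ All.map (λ {x} → Equivalence.from (P∘f⇔Q x)))

  Any-map-⇔ : ∀ xs → Any P (map f xs) ⇔ Any Q xs
  Any-map-⇔ xs = mk⇔
    (Any.map (λ {x} → Equivalence.to (P∘f⇔Q x)) ∘ AnyP.map⁻)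
    (AnyP.map⁺ ∘ Any.map (λ {x} → Equivalence.from (P∘f⇔Q x)))

module MagariProperties {c ℓ : Level} (𝔄 : MagariAlgebra c ℓ) where
  open MagariAlgebra 𝔄

  open OrderLattice.Lattice (LatticeProperties.∨-∧-orderTheoreticLattice lattice)
    using (_≤_; poset; antisym; x∧y≤x; x∧y≤y; ∧-greatest; joinSemilattice)
  open JoinSemilatticeProperties joinSemilattice using (∨-monotonic)
  open ≤-Reasoning poset

  □-mono : ∀ {x y} → x ≤ y → □ x ≤ □ y
  □-mono {x} {y} x≈x∧y = trans (□-cong x≈x∧y) (□-∧ x y)

  ∧-residual : ∀ {x y z} → x ∧ y ≤ z → x ≤ ¬ y ∨ z
  ∧-residual {x} {y} {z} x∧y≤z = begin
    x                       ≈⟨ sym (∧-identityʳ booleanAlgebra x) ⟩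
    x ∧ ⊤                   ≈⟨ ∧-cong refl (sym (∨-complementʳ y)) ⟩
    x ∧ (y ∨ ¬ y)           ≈⟨ ∧-distribˡ-∨ x y (¬ y) ⟩
    (x ∧ y) ∨ (x ∧ ¬ y)     ≤⟨ ∨-monotonic x∧y≤z (x∧y≤y x (¬ y)) ⟩
    z ∨ ¬ y                 ≈⟨ ∨-comm z (¬ y) ⟩
    ¬ y ∨ z                 ∎

  □≤□□ : ∀ x → □ x ≤ □ (□ x)
  □≤□□ x = begin
    □ x                     ≤⟨ □-mono (∧-residual x∧□□⁺x≤□⁺x) ⟩
    □ (¬ □ (□⁺ x) ∨ □⁺ x)   ≈⟨ □-löb (□⁺ x) ⟩
    □ (□⁺ x)                ≈⟨ □-∧ (□ x) x ⟩
    □ (□ x) ∧ □ x           ≤⟨ x∧y≤x _ _ ⟩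
    □ (□ x)                 ∎
    where
    x∧□□⁺x≤□⁺x : x ∧ □ (□⁺ x) ≤ □⁺ x
    x∧□□⁺x≤□⁺x = ∧-greatest x∧□□⁺x≤□x (x∧y≤x x _)
      where
      x∧□□⁺x≤□x : x ∧ □ (□⁺ x) ≤ □ x
      x∧□□⁺x≤□x = begin
        x ∧ □ (□⁺ x)        ≤⟨ x∧y≤y x _ ⟩
        □ (□⁺ x)            ≈⟨ □-∧ (□ x) x ⟩
        □ (□ x) ∧ □ x       ≤⟨ x∧y≤y _ _ ⟩
        □ x                 ∎

  ≤□⇒Open : ∀ {x} → x ≤ □ x → Open x
  ≤□⇒Open {x} x≤□x = antisym (x∧y≤y (□ x) x) (∧-greatest x≤□x (begin x ∎))

  □⁺-open : ∀ x → Open (□⁺ x)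
  □⁺-open x = ≤□⇒Open (begin
    □ x ∧ x                 ≤⟨ ∧-greatest (≤□□ (x∧y≤x (□ x) x)) (x∧y≤x (□ x) x) ⟩
    □ (□ x) ∧ □ x           ≈⟨ sym (□-∧ (□ x) x) ⟩
    □ (□⁺ x)                ∎)
    where
    ≤□□ : ∀ {y} → y ≤ □ x → y ≤ □ (□ x)
    ≤□□ {y} y≤□x = begin y ≤⟨ y≤□x ⟩ □ x ≤⟨ □≤□□ x ⟩ □ (□ x) ∎

  □⁺-valuation : (ℕ → Carrier) → ℕ → O
  □⁺-valuation v p = □⁺ (v p) , □⁺-open (v p)

  Corresponds : (ℕ → Carrier) → (ℕ → O) → Set ℓ
  Corresponds v w = ∀ p → □⁺ (v p) ≈ proj₁ (w p)

  proj₁-corresponds : ∀ w → Corresponds (proj₁ ∘ w) w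
  proj₁-corresponds w = proj₂ ∘ w

  □⁺-valuation-corresponds : ∀ v → Corresponds v (□⁺-valuation v)
  □⁺-valuation-corresponds v p = refl

  ⟦T⟧≈⟦⟧ρ : ∀ {v w} → Corresponds v w → ∀ φ → ⟦_⟧ᵈ 𝔄 (T φ) v ≈ ⟦_⟧ρ 𝔄 φ w
  ⟦T⟧≈⟦⟧ρ v~w (var p)  = v~w p
  ⟦T⟧≈⟦⟧ρ v~w ⊥ᵐ       = refl
  ⟦T⟧≈⟦⟧ρ v~w ⊤ᵐ       = refl
  ⟦T⟧≈⟦⟧ρ v~w (φ ∧ᵐ ψ) = ∧-cong (⟦T⟧≈⟦⟧ρ v~w φ) (⟦T⟧≈⟦⟧ρ v~w ψ)
  ⟦T⟧≈⟦⟧ρ v~w (φ ∨ᵐ ψ) = ∨-cong (⟦T⟧≈⟦⟧ρ v~w φ) (⟦T⟧≈⟦⟧ρ v~w ψ)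
  ⟦T⟧≈⟦⟧ρ v~w (φ →ᵐ ψ) = ∧-cong (□-cong ¬φ∨ψ) ¬φ∨ψ
    where ¬φ∨ψ = ∨-cong (¬-cong (⟦T⟧≈⟦⟧ρ v~w φ)) (⟦T⟧≈⟦⟧ρ v~w ψ)
  ⟦T⟧≈⟦⟧ρ v~w (⊠ᵐ φ)   = □-cong (⟦T⟧≈⟦⟧ρ v~w φ)

  _⊨ᵈ_ : (ℕ → Carrier) → ModForm → Set ℓ
  v ⊨ᵈ φ = ⟦_⟧ᵈ 𝔄 φ v ≈ ⊤

  _⊨ρ_ : (ℕ → O) → MsiForm → Set ℓ
  w ⊨ρ φ = ⟦_⟧ρ 𝔄 φ w ≈ ⊤

  ⊨ᵈT⇔⊨ρ : ∀ {v w} → Corresponds v w → ∀ φ → v ⊨ᵈ T φ ⇔ w ⊨ρ φ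
  ⊨ᵈT⇔⊨ρ v~w φ = mk⇔ (trans (sym (⟦T⟧≈⟦⟧ρ v~w φ))) (trans (⟦T⟧≈⟦⟧ρ v~w φ))

  Tʳ-valid-at⇔valid-at : ∀ {v w} → Corresponds v w → ∀ Γ Δ →
    (All (v ⊨ᵈ_) (map T Γ) → Any (v ⊨ᵈ_) (map T Δ)) ⇔ (All (w ⊨ρ_) Γ → Any (w ⊨ρ_) Δ)
  Tʳ-valid-at⇔valid-at v~w Γ Δ =
    →-cong-⇔ (All-map-⇔ (⊨ᵈT⇔⊨ρ v~w) Γ) (Any-map-⇔ (⊨ᵈT⇔⊨ρ v~w) Δ)

lemma5p34 : {c ℓ : Level} (𝔄 : MagariAlgebra c ℓ) (R : MsiRule) →
    ValidModal 𝔄 (Tʳ R) ⇔ ValidRho 𝔄 R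
lemma5p34 𝔄 (Γ / Δ) = mk⇔
  (λ valid w → Equivalence.to (Tʳ-valid-at⇔valid-at (proj₁-corresponds w) Γ Δ)
                 (valid (proj₁ ∘ w)))
  (λ valid v → Equivalence.from (Tʳ-valid-at⇔valid-at (□⁺-valuation-corresponds v) Γ Δ)
                 (valid (□⁺-valuation v)))
  where open MagariProperties 𝔄
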